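{- Suppose the index set $[n]$ is partitioned into $C_1,\dots,C_K$ such that for each $j\in[K]$ there is a vector $c^j\in\mathbb{R}^m$ with $\|c^j\|_\infty=1$ and $a^t=\|a^t\|_\infty c^j$ for all $t\in C_j$. For each $j$, order $C_j$ as $t_1,t_2,\dots,t_{|C_j|}$ so that $\frac{\pi_{t_1}}{\|a^{t_1}\|_\infty}\ge\frac{\pi_{t_2}}{\|a^{t_2}\|_\infty}\ge\cdots$. Then for every $j\in[K]$ and every $x\in\mathcal{X}$, the set $x\cap C_j$ is a prefix of $C_j$ in this order, i.e. of the form $\{t_1,\dots,t_r\}$ for some $r\ge0$.
   Context: Columns: rewards $\pi_1,\dots,\pi_n\ge0$ and vectors $a^1,\dots,a^n\in[0,1]^m\setminus\{0\}$. For $p\in\mathbb{R}^m$, $x(p)\in\{0,1\}^n$ has $x(p)_t=1$ iff $\pi_t>p\cdot a^t$; vectors in $\{0,1\}^n$ are identified with their supports. $\mathcal{X}=\{x(p):p\in\mathbb{R}^m_+\}$. -}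

module Defs where

open import Level using (Level; _⊔_)
open import Data.Nat using (ℕ; zero) renaming (suc to sucℕ)
open import Data.Fin using (Fin; zero; suc)
open import Data.Product using (Σ; _×_; _,_; ∃)
open import Data.Sum using (_⊎_)
open import Data.List using (List; take)
open import Relation.Nullary using (¬_)
open import Relation.Binary using (tri<; tri≈; tri>)
open import Relation.Binary.PropositionalEquality using (_≡_)
open import Algebra.Structures using (IsCommutativeRing)
open import Relation.Binary.Structures using (IsStrictTotalOrder)

-- An ordered field (with propositional equality as the carrier equality).
-- ℝ is a model; the statement is proved for every such field, in particular ℝ.
-- The inverse is total; only x ≢ 0 → x * x ⁻¹ ≡ 1 is assumed.
record OrderedField (c ℓ : Level) : Set (Level.suc (c ⊔ ℓ)) where
  infixl 7 _*_
  infixl 6 _+_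
  infix  8 -_
  infix  9 _⁻¹
  infix  4 _<_
  field
    Carrier : Set c
    _+_ _*_ : Carrier → Carrier → Carrier
    -_      : Carrier → Carrier
    _⁻¹     : Carrier → Carrier
    0# 1#   : Carrier
    _<_     : Carrier → Carrier → Set ℓ
    isCommutativeRing   : IsCommutativeRing _≡_ _+_ _*_ -_ 0# 1#
    isStrictTotalOrder  : IsStrictTotalOrder _≡_ _<_
    +-mono-<  : ∀ {x y} z → x < y → x + z < y + z
    *-pos     : ∀ {x y} → 0# < x → 0# < y → 0# < x * y
    ⁻¹-inverse : ∀ x → ¬ x ≡ 0# → x * x ⁻¹ ≡ 1#

  open IsStrictTotalOrder isStrictTotalOrder public using (compare)

  infix 4 _≤_
  _≤_ : Carrier → Carrier → Set (c ⊔ ℓ)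
  x ≤ y = x < y ⊎ x ≡ y

  infixl 7 _/_
  _/_ : Carrier → Carrier → Carrier
  x / y = x * y ⁻¹

  max : Carrier → Carrier → Carrier
  max x y with compare x y
  ... | tri< _ _ _ = y
  ... | tri≈ _ _ _ = x
  ... | tri> _ _ _ = x

  abs : Carrier → Carrier
  abs x with compare x 0#
  ... | tri< _ _ _ = - x
  ... | tri≈ _ _ _ = x
  ... | tri> _ _ _ = x

  ‖_‖∞ : ∀ {m} → (Fin m → Carrier) → Carrier
  ‖_‖∞ {zero}  v = 0#
  ‖_‖∞ {sucℕ m} v = max (abs (v zero)) (‖_‖∞ (λ i → v (suc i)))

  _·_ : ∀ {m} → (Fin m → Carrier) → (Fin m → Carrier) → Carrier
  _·_ {zero}  p a = 0#
  _·_ {sucℕ m} p a = p zero * a zero + _·_ (λ i → p (suc i)) (λ i → a (suc i))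

-- Every column of a class is a positive multiple ‖aᵗ‖∞ cʲ of the same vector, so the
-- constraint p · aᵗ < πᵗ is equivalent to p · cʲ < πᵗ / ‖aᵗ‖∞: within a class, x(p)
-- selects exactly the columns whose ratio exceeds the single threshold p · cʲ.  In a
-- list sorted by decreasing ratio such columns form a prefix.
module Submission where

open import Defs
open import Level using (Level)
open import Data.Nat using (ℕ)
open import Data.Fin using (Fin)
open import Data.Product using (Σ; _×_; _,_; ∃)
open import Data.List using (List; take)
open import Data.List.Membership.Propositional using (_∈_)
open import Data.List.Relation.Unary.Unique.Propositional using (Unique)
open import Data.List.Relation.Unary.Linked using (Linked)
open import Relation.Nullary using (¬_)
open import Relation.Binary.PropositionalEquality using (_≡_)
open import Function.Bundles using (_⇔_)

import Data.Nat as ℕ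
import Data.Fin as Fin
open import Data.List using ([]; _∷_)
open import Data.List.Relation.Unary.Any using (here; there)
import Data.List.Relation.Unary.All as All
open import Data.List.Relation.Unary.AllPairs using (AllPairs; _∷_)
import Data.List.Relation.Unary.Linked as Linked
open import Data.List.Relation.Unary.Linked.Properties using (Linked⇒AllPairs)
open import Data.Sum using (inj₁; inj₂)
open import Data.Empty using (⊥-elim)
open import Function using (_∘_)
open import Function.Bundles using (mk⇔; Equivalence)
import Function.Properties.Equivalence
open import Relation.Nullary using (yes; no; contradiction)
open import Relation.Unary using (Pred; Decidable)
open import Relation.Binary using (tri<; tri≈; tri>)
open import Relation.Binary.PropositionalEquality
  using (refl; sym; trans; cong; cong₂; subst; subst₂; module ≡-Reasoning)
open import Algebra.Structures using (IsCommutativeRing)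
open import Relation.Binary.Structures using (IsStrictTotalOrder)

module _ {a p} {A : Set a} {P : Pred A p} (P? : Decidable P) where

  satisfyingPrefixLength : List A → ℕ
  satisfyingPrefixLength []       = ℕ.zero
  satisfyingPrefixLength (x ∷ xs) with P? x
  ... | yes _ = ℕ.suc (satisfyingPrefixLength xs)
  ... | no  _ = ℕ.zero

  ∈-satisfyingPrefix⁻ : ∀ xs {t} → t ∈ take (satisfyingPrefixLength xs) xs → t ∈ xs × P t
  ∈-satisfyingPrefix⁻ (x ∷ xs) t∈ with P? x
  ∈-satisfyingPrefix⁻ (x ∷ xs) (here refl) | yes Px = here refl , Px
  ∈-satisfyingPrefix⁻ (x ∷ xs) (there t∈) | yes _  =
    let t∈xs , Pt = ∈-satisfyingPrefix⁻ xs t∈ in there t∈xs , Pt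

  ∈-satisfyingPrefix⁺ : ∀ {xs t} → AllPairs (λ s u → P u → P s) xs →
                        t ∈ xs → P t → t ∈ take (satisfyingPrefixLength xs) xs
  ∈-satisfyingPrefix⁺ {x ∷ xs} (_ ∷ closed) t∈ Pt with P? x
  ∈-satisfyingPrefix⁺ (_ ∷ _)      (here refl) Pt | yes _  = here refl
  ∈-satisfyingPrefix⁺ (_ ∷ closed) (there t∈)  Pt | yes _  = there (∈-satisfyingPrefix⁺ closed t∈ Pt)
  ∈-satisfyingPrefix⁺ (_ ∷ _)      (here refl) Pt | no ¬Px = contradiction Pt ¬Px
  ∈-satisfyingPrefix⁺ (Pu⇒Px ∷ _)  (there t∈)  Pt | no ¬Px = contradiction (All.lookup Pu⇒Px t∈ Pt) ¬Px

  satisfying-prefix : ∀ {xs} → Linked (λ s u → P u → P s) xs →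
                      ∃ λ r → ∀ t → (t ∈ xs × P t) ⇔ (t ∈ take r xs)
  satisfying-prefix {xs} closed =
    satisfyingPrefixLength xs , λ t →
      mk⇔ (λ (t∈ , Pt) → ∈-satisfyingPrefix⁺ (Linked⇒AllPairs (λ Py⇒Px Pz⇒Py → Py⇒Px ∘ Pz⇒Py) closed) t∈ Pt)
          (∈-satisfyingPrefix⁻ xs)

module OrderedFieldProperties {c ℓ} (F : OrderedField c ℓ) where
  open OrderedField F
  open IsCommutativeRing isCommutativeRing
    using (+-identityˡ; +-identityʳ; *-identityˡ; *-identityʳ; -‿inverseˡ; -‿inverseʳ;
           zeroˡ; zeroʳ; distribˡ; *-assoc; *-comm; +-assoc)
  open IsStrictTotalOrder isStrictTotalOrder using (irrefl) renaming (trans to <-trans)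
  open ≡-Reasoning

  <-irrefl : ∀ {x} → ¬ x < x
  <-irrefl = irrefl refl

  <⇒≢ : ∀ {x y} → x < y → ¬ y ≡ x
  <⇒≢ x<y refl = <-irrefl x<y

  ≤-trans : ∀ {x y z} → x ≤ y → y ≤ z → x ≤ z
  ≤-trans (inj₁ x<y) (inj₁ y<z) = inj₁ (<-trans x<y y<z)
  ≤-trans (inj₁ x<y) (inj₂ refl) = inj₁ x<y
  ≤-trans (inj₂ refl) y≤z = y≤z

  <-≤-trans : ∀ {x y z} → x < y → y ≤ z → x < z
  <-≤-trans x<y (inj₁ y<z) = <-trans x<y y<z
  <-≤-trans x<y (inj₂ refl) = x<y

  y≤max : ∀ x y → y ≤ max x y
  y≤max x y with compare x y
  ... | tri< _ _ _ = inj₂ refl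
  ... | tri≈ _ x≡y _ = inj₂ (sym x≡y)
  ... | tri> _ _ y<x = inj₁ y<x

  0≤‖‖∞ : ∀ {m} (v : Fin m → Carrier) → 0# ≤ ‖ v ‖∞
  0≤‖‖∞ {ℕ.zero}  v = inj₂ refl
  0≤‖‖∞ {ℕ.suc m} v = ≤-trans (0≤‖‖∞ (v ∘ Fin.suc)) (y≤max _ _)

  0<‖‖∞-of-ray : ∀ {m} (v w : Fin m → Carrier) →
                 (∀ i → v i ≡ ‖ v ‖∞ * w i) → ¬ (∀ i → v i ≡ 0#) → 0# < ‖ v ‖∞
  0<‖‖∞-of-ray v w v≡‖v‖w v≢0 with 0≤‖‖∞ v
  ... | inj₁ 0<‖v‖ = 0<‖v‖
  ... | inj₂ 0≡‖v‖ = ⊥-elim (v≢0 λ i → begin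
    v i            ≡⟨ v≡‖v‖w i ⟩
    ‖ v ‖∞ * w i   ≡⟨ cong (_* w i) (sym 0≡‖v‖) ⟩
    0# * w i       ≡⟨ zeroˡ (w i) ⟩
    0#             ∎)

  ·-congˡ : ∀ {m} (p : Fin m → Carrier) {v w} → (∀ i → v i ≡ w i) → p · v ≡ p · w
  ·-congˡ {ℕ.zero}  p v≡w = refl
  ·-congˡ {ℕ.suc m} p v≡w =
    cong₂ _+_ (cong (p Fin.zero *_) (v≡w Fin.zero)) (·-congˡ (p ∘ Fin.suc) (v≡w ∘ Fin.suc))

  ·-scaleˡ : ∀ {m} (p w : Fin m → Carrier) s → p · (λ i → s * w i) ≡ s * (p · w)
  ·-scaleˡ {ℕ.zero}  p w s = sym (zeroʳ s)
  ·-scaleˡ {ℕ.suc m} p w s = begin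
    p₀ * (s * w₀) + (p ∘ Fin.suc) · (λ i → s * w (Fin.suc i))
      ≡⟨ cong₂ _+_ (swap p₀ s w₀) (·-scaleˡ (p ∘ Fin.suc) (w ∘ Fin.suc) s) ⟩
    s * (p₀ * w₀) + s * ((p ∘ Fin.suc) · (w ∘ Fin.suc))
      ≡⟨ sym (distribˡ s _ _) ⟩
    s * (p · w) ∎
    where
    p₀ = p Fin.zero
    w₀ = w Fin.zero
    swap : ∀ x y z → x * (y * z) ≡ y * (x * z)
    swap x y z = begin
      x * (y * z) ≡⟨ sym (*-assoc x y z) ⟩
      x * y * z   ≡⟨ cong (_* z) (*-comm x y) ⟩
      y * x * z   ≡⟨ *-assoc y x z ⟩
      y * (x * z) ∎

  *-monoʳ-< : ∀ {z x y} → 0# < z → x < y → z * x < z * y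
  *-monoʳ-< {z} {x} {y} 0<z x<y =
    subst₂ _<_ (+-identityˡ (z * x)) z[y-x]+zx≡zy (+-mono-< (z * x) (*-pos 0<z 0<y-x))
    where
    0<y-x : 0# < y + - x
    0<y-x = subst (_< y + - x) (-‿inverseʳ x) (+-mono-< (- x) x<y)
    z[y-x]+zx≡zy : z * (y + - x) + z * x ≡ z * y
    z[y-x]+zx≡zy = begin
      z * (y + - x) + z * x ≡⟨ sym (distribˡ z (y + - x) x) ⟩
      z * (y + - x + x)     ≡⟨ cong (z *_) (+-assoc y (- x) x) ⟩
      z * (y + (- x + x))   ≡⟨ cong (λ u → z * (y + u)) (-‿inverseˡ x) ⟩
      z * (y + 0#)          ≡⟨ cong (z *_) (+-identityʳ y) ⟩
      z * y                 ∎

  0<⁻¹ : ∀ {N} → 0# < N → 0# < N ⁻¹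
  0<⁻¹ {N} 0<N with compare 0# (N ⁻¹)
  ... | tri< 0<N⁻¹ _ _ = 0<N⁻¹
  ... | tri≈ _ 0≡N⁻¹ _ = contradiction N≡0 (<⇒≢ 0<N)
    where
    N≡0 : N ≡ 0#
    N≡0 = begin
      N               ≡⟨ sym (*-identityʳ N) ⟩
      N * 1#          ≡⟨ cong (N *_) (sym (⁻¹-inverse N (<⇒≢ 0<N))) ⟩
      N * (N * N ⁻¹)  ≡⟨ cong (λ u → N * (N * u)) (sym 0≡N⁻¹) ⟩
      N * (N * 0#)    ≡⟨ cong (N *_) (zeroʳ N) ⟩
      N * 0#          ≡⟨ zeroʳ N ⟩
      0#              ∎
  ... | tri> _ _ N⁻¹<0 = ⊥-elim (<-irrefl (<-trans 0<N N<0))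
    where
    N<0 : N < 0#
    N<0 = subst₂ _<_ (*-identityʳ N) (zeroʳ N)
            (*-monoʳ-< 0<N (subst₂ _<_ (⁻¹-inverse N (<⇒≢ 0<N)) (zeroʳ N) (*-monoʳ-< 0<N N⁻¹<0)))

  *<⇔</ : ∀ {N q x} → 0# < N → (N * q < x) ⇔ (q < x / N)
  *<⇔</ {N} {q} {x} 0<N = mk⇔
    (λ Nq<x → subst₂ _<_ N⁻¹Nq≡q (*-comm (N ⁻¹) x) (*-monoʳ-< (0<⁻¹ 0<N) Nq<x))
    (λ q<x/N → subst (N * q <_) Nx/N≡x (*-monoʳ-< 0<N q<x/N))
    where
    NN⁻¹≡1 : N * N ⁻¹ ≡ 1#
    NN⁻¹≡1 = ⁻¹-inverse N (<⇒≢ 0<N)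
    N⁻¹Nq≡q : N ⁻¹ * (N * q) ≡ q
    N⁻¹Nq≡q = begin
      N ⁻¹ * (N * q) ≡⟨ sym (*-assoc _ _ _) ⟩
      N ⁻¹ * N * q   ≡⟨ cong (_* q) (trans (*-comm _ _) NN⁻¹≡1) ⟩
      1# * q         ≡⟨ *-identityˡ q ⟩
      q              ∎
    Nx/N≡x : N * (x * N ⁻¹) ≡ x
    Nx/N≡x = begin
      N * (x * N ⁻¹) ≡⟨ cong (N *_) (*-comm x _) ⟩
      N * (N ⁻¹ * x) ≡⟨ sym (*-assoc _ _ _) ⟩
      N * N ⁻¹ * x   ≡⟨ cong (_* x) NN⁻¹≡1 ⟩
      1# * x         ≡⟨ *-identityˡ x ⟩
      x              ∎

  ray-constraint⇔ratio : ∀ {m} (p v w : Fin m → Carrier) {x} → 0# < ‖ v ‖∞ →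
                         (∀ i → v i ≡ ‖ v ‖∞ * w i) → (p · v < x) ⇔ (p · w < x / ‖ v ‖∞)
  ray-constraint⇔ratio p v w 0<‖v‖ v≡‖v‖w
    rewrite trans (·-congˡ p v≡‖v‖w) (·-scaleˡ p w ‖ v ‖∞) = *<⇔</ 0<‖v‖

-- Only the ray structure, nonvanishing columns and sortedness matter.
lemma6 : ∀ {c ℓ} (F : OrderedField c ℓ) → let open OrderedField F in
  (n m K : ℕ) (π : Fin n → Carrier) (a : Fin n → Fin m → Carrier) →
  (∀ t → 0# ≤ π t) →
  (∀ t i → 0# ≤ a t i × a t i ≤ 1#) →
  (∀ t → ¬ (∀ i → a t i ≡ 0#)) →
  (cls : Fin n → Fin K) (cv : Fin K → Fin m → Carrier) →
  (∀ j → ‖ cv j ‖∞ ≡ 1#) →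
  (∀ t i → a t i ≡ ‖ a t ‖∞ * cv (cls t) i) →
  (ord : Fin K → List (Fin n)) →
  (∀ j → Unique (ord j)) →
  (∀ j t → (t ∈ ord j) ⇔ (cls t ≡ j)) →
  (∀ j → Linked (λ s t → π t / ‖ a t ‖∞ ≤ π s / ‖ a s ‖∞) (ord j)) →
  ∀ (j : Fin K) (p : Fin m → Carrier) → (∀ i → 0# ≤ p i) →
  ∃ λ (r : ℕ) → ∀ (t : Fin n) →
    ((p · a t < π t) × cls t ≡ j) ⇔ (t ∈ take r (ord j))
lemma6 F n m K π a _ _ a≢0 cls cv _ a≡‖a‖cv ord _ ord⇔cls sorted j p _ =
  let r , prefix = satisfying-prefix (λ t → q <? ratio t)
                     (Linked.map (λ ratio≤ q<ratio → <-≤-trans q<ratio ratio≤) (sorted j))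
  in r , λ t → Function.Properties.Equivalence.trans (in-class⇔ t) (prefix t)
  where
  open OrderedField F
  open OrderedFieldProperties F
  open IsStrictTotalOrder isStrictTotalOrder using (_<?_)

  ratio : Fin n → Carrier
  ratio t = π t / ‖ a t ‖∞

  q : Carrier
  q = p · cv j

  constraint⇔ratio : ∀ t → cls t ≡ j → (p · a t < π t) ⇔ (q < ratio t)
  constraint⇔ratio t refl =
    ray-constraint⇔ratio p (a t) (cv j) (0<‖‖∞-of-ray (a t) (cv j) (a≡‖a‖cv t) (a≢0 t)) (a≡‖a‖cv t)

  in-class⇔ : ∀ t → ((p · a t < π t) × cls t ≡ j) ⇔ (t ∈ ord j × q < ratio t)
  in-class⇔ t = mk⇔
    (λ (lt , t∈j) → Equivalence.from (ord⇔cls j t) t∈j , Equivalence.to (constraint⇔ratio t t∈j) lt)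
    (λ (t∈ , lt) → let t∈j = Equivalence.to (ord⇔cls j t) t∈ in
                   Equivalence.from (constraint⇔ratio t t∈j) lt , t∈j)
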